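{- For any integer $p\geq 3$, there is a finite simple bipartite graph $G$ with $n=3p-4$ vertices and biclique number $t=p-1$ such that $\varphi(G)=p=\left\lfloor \frac{n-t+4}{2}\right\rfloor$.
   Context: A biclique of $G$ is a subgraph of $G$ that is a complete bipartite graph (a single vertex being regarded as a complete bipartite graph with one side empty). The biclique number of $G$ is the minimum number of mutually vertex-disjoint bicliques of $G$ covering all vertices of $G$. A $b$-coloring of $G$ with $b$ colors is a proper coloring of $V(G)$ using exactly $b$ colors such that for every color $i$ there is a vertex of color $i$ having neighbors of all the other $b-1$ colors. The $b$-chromatic number $\varphi(G)$ (also written $b(G)$) is the largest $b$ for which such a coloring exists. -}

module Defs where

open import Data.Nat using (ℕ; _≤_)
open import Data.Fin using (Fin)
open import Data.Bool using (Bool; true; false)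
open import Data.Product using (Σ; ∃; _×_; _,_)
open import Data.Sum using (_⊎_)
open import Relation.Binary.PropositionalEquality using (_≡_; _≢_)

record SimpleGraph (n : ℕ) : Set where
  field
    adj    : Fin n → Fin n → Bool
    sym    : ∀ u v → adj u v ≡ adj v u
    irrefl : ∀ v → adj v v ≡ false
open SimpleGraph public

Adj : ∀ {n} → SimpleGraph n → Fin n → Fin n → Set
Adj G u v = adj G u v ≡ true

Bipartite : ∀ {n} → SimpleGraph n → Set
Bipartite {n} G = Σ (Fin n → Bool) λ side → ∀ u v → Adj G u v → side u ≢ side v

IsBicliqueClass : ∀ {n k} → SimpleGraph n → (Fin n → Fin k) → (Fin n → Bool) → Fin k → Set
IsBicliqueClass {n} G part side i =
  (Σ (Fin n) λ v → part v ≡ i × (∀ u → part u ≡ i → u ≡ v))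
  ⊎ ( (Σ (Fin n) λ a → part a ≡ i × side a ≡ false)
    × (Σ (Fin n) λ b → part b ≡ i × side b ≡ true)
    × (∀ u v → part u ≡ i → part v ≡ i → side u ≡ false → side v ≡ true → Adj G u v))

HasBicliqueCover : ∀ {n} → SimpleGraph n → ℕ → Set
HasBicliqueCover {n} G k =
  Σ (Fin n → Fin k) λ part → Σ (Fin n → Bool) λ side →
    ∀ i → IsBicliqueClass G part side i

BicliqueNumber : ∀ {n} → SimpleGraph n → ℕ → Set
BicliqueNumber G t = HasBicliqueCover G t × (∀ k → HasBicliqueCover G k → t ≤ k)

IsBColoring : ∀ {n b} → SimpleGraph n → (Fin n → Fin b) → Set
IsBColoring {n} {b} G c =
    (∀ u v → Adj G u v → c u ≢ c v)
  × (∀ (i : Fin b) → ∃ λ v → c v ≡ i)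
  × (∀ (i : Fin b) → Σ (Fin n) λ v → c v ≡ i ×
       (∀ (j : Fin b) → j ≢ i → Σ (Fin n) λ u → Adj G v u × c u ≡ j))

HasBColoring : ∀ {n} → SimpleGraph n → ℕ → Set
HasBColoring {n} G b = Σ (Fin n → Fin b) λ c → IsBColoring G c

BChromaticNumber : ∀ {n} → SimpleGraph n → ℕ → Set
BChromaticNumber G p = HasBColoring G p × (∀ b → HasBColoring G b → b ≤ p)

-- The graph: a hub joined to inner vertices v₀ … v_{p-2}, each v_j joined to the outer vertices
-- w_k with k ≠ j (a crown), and p - 3 isolated vertices. Colouring the hub 0 and v_j, w_j with
-- j + 1 is a b-colouring whose dominating vertices are the hub and the v_j; no b-colouring has
-- more colours since the maximum degree is p - 1. The bicliques {hub, w₁, …; v₀} and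
-- {w₀; v₁, …} together with singletons cover the graph, and no cover is smaller: an isolated
-- vertex is alone in its biclique, and every edge has an outer vertex adjacent to neither of its
-- ends, which therefore cannot share its biclique.
module Submission where

open import Defs
open import Data.Bool using (Bool; true; false)
open import Data.Empty using (⊥-elim)
open import Data.Fin using (Fin; zero; suc; splitAt; _↑ˡ_; _↑ʳ_)
open import Data.Fin.Properties using (splitAt-↑ˡ; splitAt-↑ʳ; splitAt⁻¹-↑ˡ; splitAt⁻¹-↑ʳ; injective⇒≤; suc-injective; _≟_)
open import Data.Nat using (ℕ; _≤_; _+_; _*_; _∸_; _/_; zero; suc; z≤n; s≤s)
open import Data.Nat.DivMod using (+-distrib-/-∣ʳ; m*n/n≡m)
open import Data.Nat.Divisibility using (n∣m*n)
open import Data.Nat.Properties using (m+n∸n≡m; m+n∸m≡n)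
open import Data.Nat.Tactic.RingSolver using (solve-∀)
open import Data.Product using (Σ; _×_; _,_; proj₁; proj₂)
open import Data.Sum using (inj₁; inj₂; [_,_]′)
open import Function using (_∘_)
open import Function.Bundles using (mk⇔)
open import Function.Definitions using (Injective)
open import Relation.Binary.PropositionalEquality as ≡ using (_≡_; _≢_; refl; cong; subst; subst₂)
open import Relation.Nullary using (Dec; yes; no; ¬_; ¬?; contradiction)
open import Relation.Nullary.Decidable using (does; map′; dec-true; dec-false; does-⇔)

Adj-sym : ∀ {n} (G : SimpleGraph n) {u v} → Adj G u v → Adj G v u
Adj-sym G {u} {v} uv = ≡.trans (sym G v u) uv

false≢true : ∀ {b c : Bool} → b ≡ false → c ≡ true → b ≢ c
false≢true refl refl ()

Isolated : ∀ {n} → SimpleGraph n → Fin n → Set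
Isolated {n} G v = ∀ u → ¬ Adj G v u

module BicliqueCover {n k} (G : SimpleGraph n) (part : Fin n → Fin k) (side : Fin n → Bool)
                     (isClass : ∀ i → IsBicliqueClass G part side i) where

  cross-adjacent : ∀ {x y} → part x ≡ part y → side x ≢ side y → Adj G x y
  cross-adjacent {x} {y} px≡py sx≢sy with isClass (part y)
  ... | inj₁ (_ , _ , only) =
    contradiction (cong side (≡.trans (only x px≡py) (≡.sym (only y refl)))) sx≢sy
  ... | inj₂ (_ , _ , complete) with side x in sx | side y in sy
  ... | false | true  = complete x y px≡py refl sx sy
  ... | true  | false = Adj-sym G (complete y x refl px≡py sy sx)
  ... | false | false = contradiction refl sx≢sy
  ... | true  | true  = contradiction refl sx≢sy

  isolated-alone : ∀ {z u} → Isolated G z → part u ≡ part z → u ≡ z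
  isolated-alone {z} {u} isolated pu≡pz with isClass (part z)
  ... | inj₁ (_ , _ , only) = ≡.trans (only u pu≡pz) (≡.sym (only z refl))
  ... | inj₂ ((x , px , sx) , (y , py , sy) , _) with side z in sz
  ... | false = ⊥-elim (isolated y (cross-adjacent (≡.sym py) (false≢true sz sy)))
  ... | true  = ⊥-elim (isolated x (cross-adjacent (≡.sym px) (≡.≢-sym (false≢true sx sz))))

  commonNonNeighbour-apart : ∀ {x y w} → part x ≡ part y → side x ≡ false → side y ≡ true →
                             ¬ Adj G w x → ¬ Adj G w y → part w ≢ part x
  commonNonNeighbour-apart {x} {y} {w} px≡py sx sy ¬wx ¬wy pw≡px with side w in sw
  ... | false = ¬wy (cross-adjacent (≡.trans pw≡px px≡py) (false≢true sw sy))
  ... | true  = ¬wx (cross-adjacent pw≡px (≡.≢-sym (false≢true sx sw)))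

  2+isolated≤classes : ∀ {m} (z : Fin m → Fin n) → Injective _≡_ _≡_ z → (∀ l → Isolated G (z l)) →
                       ∀ {x y} → part x ≢ part y → (∀ l → x ≢ z l) → (∀ l → y ≢ z l) → 2 + m ≤ k
  2+isolated≤classes {m} z z-injective z-isolated {x} {y} px≢py x∉z y∉z = injective⇒≤ f-injective
    where
    f : Fin (2 + m) → Fin k
    f zero          = part x
    f (suc zero)    = part y
    f (suc (suc l)) = part (z l)

    apart : ∀ {u} → (∀ l → u ≢ z l) → ∀ l → part u ≢ part (z l)
    apart u∉z l pu≡pz = u∉z l (isolated-alone (z-isolated l) pu≡pz)

    f-injective : Injective _≡_ _≡_ f
    f-injective {zero}          {zero}           _ = refl
    f-injective {zero}          {suc zero}       e = contradiction e px≢py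
    f-injective {zero}          {suc (suc l)}    e = contradiction e (apart x∉z l)
    f-injective {suc zero}      {zero}           e = contradiction (≡.sym e) px≢py
    f-injective {suc zero}      {suc zero}       _ = refl
    f-injective {suc zero}      {suc (suc l)}    e = contradiction e (apart y∉z l)
    f-injective {suc (suc l)}   {zero}           e = contradiction (≡.sym e) (apart x∉z l)
    f-injective {suc (suc l)}   {suc zero}       e = contradiction (≡.sym e) (apart y∉z l)
    f-injective {suc (suc l)}   {suc (suc l′)}   e =
      cong (λ l → suc (suc l)) (z-injective (isolated-alone (z-isolated l′) e))

MaxDegree≤ : ∀ {n} → SimpleGraph n → ℕ → Set
MaxDegree≤ {n} G Δ = ∀ v → Σ (Fin n → Fin Δ) λ label →
  ∀ {u u′} → Adj G v u → Adj G v u′ → label u ≡ label u′ → u ≡ u′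

HasBColoring⇒≤1+Δ : ∀ {n} {G : SimpleGraph n} {Δ} → MaxDegree≤ G Δ →
                    ∀ b → HasBColoring G b → b ≤ suc Δ
HasBColoring⇒≤1+Δ _ zero _ = z≤n
HasBColoring⇒≤1+Δ {n} {G} {Δ} maxDegree (suc b) (c , _ , _ , dominating) =
  s≤s (injective⇒≤ {f = label ∘ neighbour} label∘neighbour-injective)
  where
  v : Fin n
  v = proj₁ (dominating zero)

  rainbow : ∀ j → Σ (Fin n) λ u → Adj G v u × c u ≡ suc j
  rainbow j = proj₂ (proj₂ (dominating zero)) (suc j) λ ()

  neighbour : Fin b → Fin n
  neighbour j = proj₁ (rainbow j)

  v∼neighbour : ∀ j → Adj G v (neighbour j)
  v∼neighbour j = proj₁ (proj₂ (rainbow j))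

  c∘neighbour : ∀ j → c (neighbour j) ≡ suc j
  c∘neighbour j = proj₂ (proj₂ (rainbow j))

  label : Fin n → Fin Δ
  label = proj₁ (maxDegree v)

  label∘neighbour-injective : Injective _≡_ _≡_ (label ∘ neighbour)
  label∘neighbour-injective {j} {j′} e = suc-injective (begin
    suc j            ≡⟨ ≡.sym (c∘neighbour j) ⟩
    c (neighbour j)  ≡⟨ cong c (proj₂ (maxDegree v) (v∼neighbour j) (v∼neighbour j′) e) ⟩
    c (neighbour j′) ≡⟨ c∘neighbour j′ ⟩
    suc j′           ∎)
    where open ≡.≡-Reasoning

module Construction (q : ℕ) where

  a : ℕ
  a = 2 + q

  data V : Set where
    hub   : V
    inner : Fin a → V
    outer : Fin a → V
    lone  : Fin q → V

  N : ℕ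
  N = suc (a + (a + q))

  dec : Fin N → V
  dec zero    = hub
  dec (suc i) = [ inner , [ outer , lone ]′ ∘ splitAt a ]′ (splitAt a i)

  enc : V → Fin N
  enc hub       = zero
  enc (inner j) = suc (j ↑ˡ (a + q))
  enc (outer j) = suc (a ↑ʳ (j ↑ˡ q))
  enc (lone l)  = suc (a ↑ʳ (a ↑ʳ l))

  dec-enc : ∀ x → dec (enc x) ≡ x
  dec-enc hub       = refl
  dec-enc (inner j) rewrite splitAt-↑ˡ a j (a + q) = refl
  dec-enc (outer j) rewrite splitAt-↑ʳ a (a + q) (j ↑ˡ q) | splitAt-↑ˡ a j q = refl
  dec-enc (lone l)  rewrite splitAt-↑ʳ a (a + q) (a ↑ʳ l) | splitAt-↑ʳ a q l = refl

  enc-dec : ∀ i → enc (dec i) ≡ i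
  enc-dec zero = refl
  enc-dec (suc i) with splitAt a i in eq
  ... | inj₁ j = cong suc (splitAt⁻¹-↑ˡ eq)
  ... | inj₂ k with splitAt a k in eq′
  ...   | inj₁ j = cong suc (≡.trans (cong (a ↑ʳ_) (splitAt⁻¹-↑ˡ eq′)) (splitAt⁻¹-↑ʳ eq))
  ...   | inj₂ l = cong suc (≡.trans (cong (a ↑ʳ_) (splitAt⁻¹-↑ʳ eq′)) (splitAt⁻¹-↑ʳ eq))

  enc-injective : Injective _≡_ _≡_ enc
  enc-injective {x} {y} e = ≡.trans (≡.sym (dec-enc x)) (≡.trans (cong dec e) (dec-enc y))

  enc-≢ : ∀ {x y} → x ≢ y → enc x ≢ enc y
  enc-≢ x≢y = x≢y ∘ enc-injective

  dec-injective : Injective _≡_ _≡_ dec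
  dec-injective {i} {j} e = ≡.trans (≡.sym (enc-dec i)) (≡.trans (cong enc e) (enc-dec j))

  data Edge : V → V → Set where
    hub-inner   : ∀ j → Edge hub (inner j)
    inner-hub   : ∀ j → Edge (inner j) hub
    inner-outer : ∀ {j k} → j ≢ k → Edge (inner j) (outer k)
    outer-inner : ∀ {j k} → j ≢ k → Edge (outer k) (inner j)

  Edge-sym : ∀ {x y} → Edge x y → Edge y x
  Edge-sym (hub-inner j)     = inner-hub j
  Edge-sym (inner-hub j)     = hub-inner j
  Edge-sym (inner-outer j≢k) = outer-inner j≢k
  Edge-sym (outer-inner j≢k) = inner-outer j≢k

  Edge-irrefl : ∀ {x} → ¬ Edge x x
  Edge-irrefl ()

  edge? : ∀ x y → Dec (Edge x y)
  edge? hub       (inner j) = yes (hub-inner j)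
  edge? (inner j) hub       = yes (inner-hub j)
  edge? (inner j) (outer k) = map′ inner-outer (λ { (inner-outer j≢k) → j≢k }) (¬? (j ≟ k))
  edge? (outer k) (inner j) = map′ outer-inner (λ { (outer-inner j≢k) → j≢k }) (¬? (j ≟ k))
  edge? hub       hub       = no λ ()
  edge? hub       (outer _) = no λ ()
  edge? hub       (lone _)  = no λ ()
  edge? (inner _) (inner _) = no λ ()
  edge? (inner _) (lone _)  = no λ ()
  edge? (outer _) hub       = no λ ()
  edge? (outer _) (outer _) = no λ ()
  edge? (outer _) (lone _)  = no λ ()
  edge? (lone _)  _         = no λ ()

  G : SimpleGraph N
  G = record
    { adj    = λ u v → does (edge? (dec u) (dec v))
    ; sym    = λ u v → does-⇔ (mk⇔ Edge-sym Edge-sym) (edge? (dec u) (dec v)) (edge? (dec v) (dec u))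
    ; irrefl = λ v → dec-false (edge? (dec v) (dec v)) Edge-irrefl
    }

  Adj⇒Edge : ∀ {u v} → Adj G u v → Edge (dec u) (dec v)
  Adj⇒Edge {u} {v} uv with edge? (dec u) (dec v)
  ... | yes e = e

  Edge⇒Adj : ∀ {u v} → Edge (dec u) (dec v) → Adj G u v
  Edge⇒Adj {u} {v} = dec-true (edge? (dec u) (dec v))

  Edge⇒Adj-enc : ∀ {x y} → Edge x y → Adj G (enc x) (enc y)
  Edge⇒Adj-enc {x} {y} e =
    Edge⇒Adj {enc x} {enc y} (subst₂ Edge (≡.sym (dec-enc x)) (≡.sym (dec-enc y)) e)

  ¬Edge⇒¬Adj-enc : ∀ {x u} → ¬ Edge x (dec u) → ¬ Adj G (enc x) u
  ¬Edge⇒¬Adj-enc {x} {u} ¬e = ¬e ∘ subst (λ y → Edge y (dec u)) (dec-enc x) ∘ Adj⇒Edge {enc x} {u}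

  side : V → Bool
  side (inner _) = true
  side _         = false

  Edge⇒side≢ : ∀ {x y} → Edge x y → side x ≢ side y
  Edge⇒side≢ (hub-inner _)   ()
  Edge⇒side≢ (inner-hub _)   ()
  Edge⇒side≢ (inner-outer _) ()
  Edge⇒side≢ (outer-inner _) ()

  bipartite : Bipartite G
  bipartite = side ∘ dec , λ u v → Edge⇒side≢ ∘ Adj⇒Edge {u} {v}

  class : V → Fin a
  class hub               = zero
  class (inner zero)      = zero
  class (inner (suc _))   = suc zero
  class (outer zero)      = suc zero
  class (outer (suc _))   = zero
  class (lone l)          = suc (suc l)

  class₀-complete : ∀ x y → class x ≡ zero → class y ≡ zero →
                    side x ≡ false → side y ≡ true → Edge x y
  class₀-complete hub             (inner zero)    _ _ _ _ = hub-inner zero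
  class₀-complete (outer (suc k)) (inner zero)    _ _ _ _ = outer-inner λ ()
  class₀-complete (inner _)       _               _ _ () _
  class₀-complete (outer zero)    _               () _ _ _
  class₀-complete (lone _)        _               () _ _ _
  class₀-complete _               hub             _ _ _ ()
  class₀-complete _               (outer _)       _ _ _ ()
  class₀-complete _               (lone _)        _ _ _ ()
  class₀-complete _               (inner (suc _)) _ () _ _

  class₁-complete : ∀ x y → class x ≡ suc zero → class y ≡ suc zero →
                    side x ≡ false → side y ≡ true → Edge x y
  class₁-complete (outer zero)    (inner (suc j)) _ _ _ _ = outer-inner λ ()
  class₁-complete hub             _               () _ _ _
  class₁-complete (inner _)       _               _ _ () _
  class₁-complete (outer (suc _)) _               () _ _ _
  class₁-complete (lone _)        _               () _ _ _
  class₁-complete _               hub             _ _ _ ()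
  class₁-complete _               (outer _)       _ _ _ ()
  class₁-complete _               (lone _)        _ _ _ ()
  class₁-complete _               (inner zero)    _ () _ _

  class-lone : ∀ {l} x → class x ≡ suc (suc l) → x ≡ lone l
  class-lone hub             ()
  class-lone (inner zero)    ()
  class-lone (inner (suc _)) ()
  class-lone (outer zero)    ()
  class-lone (outer (suc _)) ()
  class-lone (lone _)        refl = refl

  member : ∀ x → Σ (Fin N) λ u → class (dec u) ≡ class x × side (dec u) ≡ side x
  member x = enc x , cong class (dec-enc x) , cong side (dec-enc x)

  cover : HasBicliqueCover G a
  cover = class ∘ dec , side ∘ dec , isClass
    where
    isClass : ∀ i → IsBicliqueClass G (class ∘ dec) (side ∘ dec) i
    isClass zero = inj₂ (member hub , member (inner zero) ,
      λ u v cu cv su sv → Edge⇒Adj {u} {v} (class₀-complete (dec u) (dec v) cu cv su sv))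
    isClass (suc zero) = inj₂ (member (outer zero) , member (inner (suc zero)) ,
      λ u v cu cv su sv → Edge⇒Adj {u} {v} (class₁-complete (dec u) (dec v) cu cv su sv))
    isClass (suc (suc l)) = inj₁ (enc (lone l) , cong class (dec-enc (lone l)) ,
      λ u cu → ≡.trans (≡.sym (enc-dec u)) (cong enc (class-lone (dec u) cu)))

  outer≁inner : ∀ j → ¬ Edge (outer j) (inner j)
  outer≁inner j (outer-inner j≢j) = j≢j refl

  commonNonNeighbour : ∀ {x y} → Edge x y → Σ (Fin a) λ j → ¬ Edge (outer j) x × ¬ Edge (outer j) y
  commonNonNeighbour (hub-inner j)         = j , (λ ()) , outer≁inner j
  commonNonNeighbour (inner-hub j)         = j , outer≁inner j , λ ()
  commonNonNeighbour (inner-outer {j} _)   = j , outer≁inner j , λ ()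
  commonNonNeighbour (outer-inner {j} _)   = j , (λ ()) , outer≁inner j

  outer-outside-hubClass : ∀ {k} {part : Fin N → Fin k} {side′ : Fin N → Bool} →
                           (∀ i → IsBicliqueClass G part side′ i) →
                           Σ (Fin a) λ j → part (enc (outer j)) ≢ part (enc hub)
  outer-outside-hubClass {part = part} {side′} isClass with isClass (part (enc hub))
  ... | inj₁ (_ , _ , only) =
    zero , λ e → enc-≢ {outer zero} {hub} (λ ()) (≡.trans (only _ e) (≡.sym (only _ refl)))
  ... | inj₂ ((x , px , sx) , (y , py , sy) , complete)
    with commonNonNeighbour (Adj⇒Edge {x} {y} (complete x y px py sx sy))
  ... | j , ¬jx , ¬jy = j , λ e →
    commonNonNeighbour-apart {x} {y} {enc (outer j)} (≡.trans px (≡.sym py)) sx sy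
      (¬Edge⇒¬Adj-enc {outer j} {x} ¬jx) (¬Edge⇒¬Adj-enc {outer j} {y} ¬jy) (≡.trans e (≡.sym px))
    where open BicliqueCover G part side′ isClass

  lone-injective : Injective _≡_ _≡_ (enc ∘ lone)
  lone-injective {l} {l′} e with enc-injective {lone l} {lone l′} e
  ... | refl = refl

  lone-isolated : ∀ l → Isolated G (enc (lone l))
  lone-isolated l u = ¬Edge⇒¬Adj-enc {lone l} {u} λ ()

  a≤coverSize : ∀ k → HasBicliqueCover G k → a ≤ k
  a≤coverSize k (part , side′ , isClass) =
    2+isolated≤classes (enc ∘ lone) lone-injective lone-isolated {enc (outer j)} {enc hub} outside
      (λ l → enc-≢ {outer j} {lone l} λ ()) (λ l → enc-≢ {hub} {lone l} λ ())
    where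
    open BicliqueCover G part side′ isClass
    j = proj₁ (outer-outside-hubClass isClass)
    outside = proj₂ (outer-outside-hubClass isClass)

  bicliqueNumber : BicliqueNumber G a
  bicliqueNumber = cover , a≤coverSize

  colour : V → Fin (suc a)
  colour hub       = zero
  colour (inner j) = suc j
  colour (outer k) = suc k
  colour (lone _)  = zero

  Edge⇒colour≢ : ∀ {x y} → Edge x y → colour x ≢ colour y
  Edge⇒colour≢ (hub-inner _)     ()
  Edge⇒colour≢ (inner-hub _)     ()
  Edge⇒colour≢ (inner-outer j≢k) = j≢k ∘ suc-injective
  Edge⇒colour≢ (outer-inner j≢k) = j≢k ∘ ≡.sym ∘ suc-injective

  dominator : Fin (suc a) → V
  dominator zero    = hub
  dominator (suc i) = inner i

  colour-dominator : ∀ i → colour (dominator i) ≡ i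
  colour-dominator zero    = refl
  colour-dominator (suc _) = refl

  dominator-sees : ∀ i j → j ≢ i → Σ V λ y → Edge (dominator i) y × colour y ≡ j
  dominator-sees zero    zero    j≢i = contradiction refl j≢i
  dominator-sees zero    (suc j) _   = inner j , hub-inner j , refl
  dominator-sees (suc i) zero    _   = hub , inner-hub i , refl
  dominator-sees (suc i) (suc j) j≢i = outer j , inner-outer (j≢i ∘ cong suc ∘ ≡.sym) , refl

  colour-enc : ∀ x → colour (dec (enc x)) ≡ colour x
  colour-enc x = cong colour (dec-enc x)

  bColoring : HasBColoring G (suc a)
  bColoring = colour ∘ dec , proper ,
              (λ i → proj₁ (dominating i) , proj₁ (proj₂ (dominating i))) , dominating
    where
    proper : ∀ u v → Adj G u v → colour (dec u) ≢ colour (dec v)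
    proper u v = Edge⇒colour≢ ∘ Adj⇒Edge {u} {v}

    dominating : ∀ i → Σ (Fin N) λ v → colour (dec v) ≡ i ×
                   (∀ j → j ≢ i → Σ (Fin N) λ u → Adj G v u × colour (dec u) ≡ j)
    dominating i =
      enc (dominator i) , ≡.trans (colour-enc (dominator i)) (colour-dominator i) , λ j j≢i →
      let (y , e , cy) = dominator-sees i j j≢i in
      enc y , Edge⇒Adj-enc e , ≡.trans (colour-enc y) cy

  neighbourIndex : V → V → Fin a
  neighbourIndex (inner j) hub       = j
  neighbourIndex _         (inner j) = j
  neighbourIndex _         (outer k) = k
  neighbourIndex _         _         = zero

  neighbourIndex-injective : ∀ {x y y′} → Edge x y → Edge x y′ →
                             neighbourIndex x y ≡ neighbourIndex x y′ → y ≡ y′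
  neighbourIndex-injective (hub-inner _)     (hub-inner _)     e = cong inner e
  neighbourIndex-injective (inner-hub _)     (inner-hub _)     _ = refl
  neighbourIndex-injective (inner-hub _)     (inner-outer j≢k) e = contradiction e j≢k
  neighbourIndex-injective (inner-outer j≢k) (inner-hub _)     e = contradiction (≡.sym e) j≢k
  neighbourIndex-injective (inner-outer _)   (inner-outer _)   e = cong outer e
  neighbourIndex-injective (outer-inner _)   (outer-inner _)   e = cong inner e

  maxDegree : MaxDegree≤ G a
  maxDegree v = neighbourIndex (dec v) ∘ dec , λ {u} {u′} vu vu′ e →
    dec-injective (neighbourIndex-injective (Adj⇒Edge {v} {u} vu) (Adj⇒Edge {v} {u′} vu′) e)

  bChromaticNumber : BChromaticNumber G (suc a)
  bChromaticNumber = bColoring , HasBColoring⇒≤1+Δ {G = G} maxDegree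

3*[3+q]∸4≡[2+q]+[3+q+q] : ∀ q → 3 * (3 + q) ∸ 4 ≡ (2 + q) + (3 + q + q)
3*[3+q]∸4≡[2+q]+[3+q+q] q = ≡.trans (cong (_∸ 4) (expand q)) (m+n∸n≡m _ 4)
  where
  expand : ∀ q → 3 * (3 + q) ≡ (2 + q) + (3 + q + q) + 4
  expand = solve-∀

vertexCount : ∀ q → 3 * (3 + q) ∸ 4 ≡ Construction.N q
vertexCount q = ≡.trans (3*[3+q]∸4≡[2+q]+[3+q+q] q) (regroup q)
  where
  regroup : ∀ q → (2 + q) + (3 + q + q) ≡ suc ((2 + q) + ((2 + q) + q))
  regroup = solve-∀

half-of-odd : ∀ m → (1 + m * 2) / 2 ≡ m
half-of-odd m = ≡.trans (+-distrib-/-∣ʳ 1 {m * 2} {2} (n∣m*n m)) (m*n/n≡m m 2)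

floor-identity : ∀ q → (3 * (3 + q) ∸ 4 ∸ (2 + q) + 4) / 2 ≡ 3 + q
floor-identity q = begin
  (3 * (3 + q) ∸ 4 ∸ (2 + q) + 4) / 2
    ≡⟨ cong (λ m → (m ∸ (2 + q) + 4) / 2) (3*[3+q]∸4≡[2+q]+[3+q+q] q) ⟩
  ((2 + q) + (3 + q + q) ∸ (2 + q) + 4) / 2
    ≡⟨ cong (λ m → (m + 4) / 2) (m+n∸m≡n (2 + q) _) ⟩
  (3 + q + q + 4) / 2
    ≡⟨ cong (_/ 2) (double q) ⟩
  (1 + (3 + q) * 2) / 2
    ≡⟨ half-of-odd (3 + q) ⟩
  3 + q
    ∎
  where
  open ≡.≡-Reasoning
  double : ∀ q → 3 + q + q + 4 ≡ 1 + (3 + q) * 2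
  double = solve-∀

Realisation : ℕ → ℕ → Set
Realisation p n = Σ (SimpleGraph n) λ G → Bipartite G × BicliqueNumber G (p ∸ 1) × BChromaticNumber G p

realisation : ∀ q → Realisation (3 + q) (Construction.N q)
realisation q = G , bipartite , bicliqueNumber , bChromaticNumber
  where open Construction q

proposition2 : (p : ℕ) → 3 ≤ p →
    Σ (SimpleGraph (3 * p ∸ 4)) λ G →
      Bipartite G × BicliqueNumber G (p ∸ 1) × BChromaticNumber G p
      × p ≡ ((3 * p ∸ 4) ∸ (p ∸ 1) + 4) / 2
proposition2 _ (s≤s (s≤s (s≤s {n = q} z≤n)))
  with subst (Realisation (3 + q)) (≡.sym (vertexCount q)) (realisation q)
... | G , bipartite , bicliqueNumber , bChromaticNumber =
  G , bipartite , bicliqueNumber , bChromaticNumber , ≡.sym (floor-identity q)
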